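{- Let $\Psi$ be a fan-in $2$ noncommutative arithmetic circuit computing $\mathrm{Pal}_{n,n}(X,Y)$, with the sets $\mathcal{B}_k$, $\mathcal{M}_k$, $\mathcal{Q}$ defined as in the context. Then for every $k\in[d']$, every element $v\in\mathcal{B}_k$ admits a valid parameterization $v=p_1p_2\cdots p_r\,q$ in which all class indices $m_1>\cdots>m_r$ are at most $k$.
   Context: Let $\mathbb{F}$ be a field, $X=\{x_1,\dots,x_n\}$, $Y=\{y_1,\dots,y_n\}$ disjoint sets of noncommuting variables, and $\mathrm{Pal}_{n,n}(X,Y)=\sum_{(i_1,\dots,i_n)\in[n]^n} x_{i_1}\cdots x_{i_n}\,y_{i_n}\cdots y_{i_1}$. A fan-in $2$ noncommutative arithmetic circuit is a DAG whose leaves are labeled by field constants or variables, whose internal nodes (gates) are labeled $+$ or $\times$, each of in-degree exactly $2$, with designated left/right children at $\times$ gates; edges may carry field-constant weights scaling the polynomial along the edge. For a gate $g$, $\widehat g$ denotes the polynomial it computes. The syntactic degree $d(g)$: variable leaves have degree $1$, constant leaves degree $0$, $+$ gates take the maximum of children's degrees, $\times$ gates the sum. Construction: Let $l_1<\cdots<l_{d'}$ be the distinct syntactic degrees appearing in $\Psi$. For $k\in[d']$ let $P_k$ be the set of $\times$ gates $g$ with $d(g)=l_k$. For a gate $g$, $\widehat g_X\in\mathbb{F}\langle X\rangle$ is the sum of all non-constant monomials of $\widehat g$ involving only $X$-variables. Let $\mathcal{M}_k=\{\widehat a_X : \text{there is a }\times\text{ gate } g\in P_k \text{ with left child } a\}$.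 Define $\mathcal{B}_1=\{1,x_1,\dots,x_n\}$ and for $2\le k\le d'$, $\mathcal{B}_k=\mathcal{B}_{k-1}\cup\{\widehat g_X\mid g\in P_k\}\cup\{p\,h\mid p\in\mathcal{M}_k, h\in\mathcal{B}_{k-1}\}$. Let $\mathcal{Q}=\mathcal{B}_1\cup\{\widehat g_X\mid g\text{ a }\times\text{ gate of }\Psi\}$. A valid parameterization of $v\in\mathbb{F}\langle X\rangle$ is an expression $v=p_1p_2\cdots p_r\,q$ with $r\ge0$, $q\in\mathcal{Q}$, each $p_i\in\mathcal{M}_{m_i}$, and $d'\ge m_1>m_2>\cdots>m_r\ge1$ (for $r=0$ it is $v=q$); the $m_i$ are its class indices and $r$ its length. -}

module Defs where

open import Level using (Level; _⊔_; Lift)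
open import Algebra.Bundles using (CommutativeRing)
open import Data.Nat as ℕ using (ℕ; zero; suc; _<_; _≤_; _>_) renaming (_+_ to _+ℕ_; _⊔_ to _⊔ℕ_)
open import Data.Fin as Fin using (Fin; fromℕ<)
open import Data.Fin.Properties using (any?)
open import Data.Sum using (_⊎_; inj₁; inj₂)
import Data.Sum.Properties as SumP
import Data.Fin.Properties as FinP
import Data.List.Properties as ListP
open import Data.Product using (Σ; ∃; ∃-syntax; _×_; _,_; proj₁; proj₂; map₁)
open import Data.List using (List; []; _∷_; map; foldr; reverse; _++_; length; filter; upTo; allFin; concatMap; lookup)
open import Data.List.Relation.Unary.All using (All)
open import Data.List.Relation.Unary.Linked using (Linked)
open import Data.Bool using (Bool; true; false; if_then_else_)
open import Relation.Nullary using (¬_; Dec; yes; no)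
open import Relation.Nullary.Decidable using (⌊_⌋)
open import Relation.Binary.PropositionalEquality using (_≡_)

record IsField {c ℓ} (R : CommutativeRing c ℓ) : Set (c ⊔ ℓ) where
  open CommutativeRing R
  field
    0≉1     : ¬ (0# ≈ 1#)
    inverse : ∀ x → ¬ (x ≈ 0#) → Σ Carrier (λ y → (x * y) ≈ 1#)

-- A variable is inj₁ i (= x_i) or inj₂ i (= y_i); a monomial is a word
-- of variables; a polynomial is its coefficient function on words
-- (the polynomials considered are all finitely supported; equality is
-- coefficientwise).

Var : ℕ → Set
Var n = Fin n ⊎ Fin n

Word : ℕ → Set
Word n = List (Var n)

splits : ∀ {A : Set} → List A → List (List A × List A)
splits []      = ([] , []) ∷ []
splits (a ∷ w) = ([] , a ∷ w) ∷ map (map₁ (a ∷_)) (splits w)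

isXWord : ∀ {n} → Word n → Bool
isXWord []  = false
isXWord (w ∷ ws) = allX (w ∷ ws)
  where
  allX : ∀ {n} → Word n → Bool
  allX [] = true
  allX (inj₁ _ ∷ vs) = allX vs
  allX (inj₂ _ ∷ vs) = false

≟W : ∀ {n} (u v : Word n) → Dec (u ≡ v)
≟W = ListP.≡-dec (SumP.≡-dec FinP._≟_ FinP._≟_)

module Poly {c ℓ} (F : CommutativeRing c ℓ) (n : ℕ) where
  open CommutativeRing F

  Pol : Set c
  Pol = Word n → Carrier

  infix 4 _≈P_
  _≈P_ : Pol → Pol → Set ℓ
  p ≈P q = ∀ w → p w ≈ q w

  constP : Carrier → Pol
  constP a [] = a
  constP a (_ ∷ _) = 0#

  oneP : Pol
  oneP = constP 1#

  zeroP : Pol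
  zeroP _ = 0#

  varP : Var n → Pol
  varP x w = if ⌊ ≟W w (x ∷ []) ⌋ then 1# else 0#

  _+P_ : Pol → Pol → Pol
  (p +P q) w = p w + q w

  scaleP : Carrier → Pol → Pol
  scaleP a p w = a * p w

  _*P_ : Pol → Pol → Pol
  (p *P q) w = foldr (λ uv acc → (p (proj₁ uv) * q (proj₂ uv)) + acc) 0# (splits w)

  monoP : Word n → Pol
  monoP w = foldr (λ x acc → varP x *P acc) oneP w

  sumP : List Pol → Pol
  sumP = foldr _+P_ zeroP

  Xpart : Pol → Pol
  Xpart p w = if isXWord w then p w else 0#

  tuples : ℕ → List (List (Fin n))
  tuples zero    = [] ∷ []
  tuples (suc k) = concatMap (λ i → map (i ∷_) (tuples k)) (allFin n)

  Pal : Pol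
  Pal = sumP (map (λ u → monoP (map inj₁ u ++ map inj₂ (reverse u))) (tuples n))

-- A gate whose children are referred to by elements of A.
-- add a wa b wb : the + gate computing wa·â + wb·b̂
-- mul a wa b wb : the × gate computing (wa·â)(wb·b̂), a = left child,
--                 b = right child; wa, wb are the edge weights.

data Gate {c} (K : Set c) (n : ℕ) (A : Set) : Set c where
  constG : K → Gate K n A
  varG   : Var n → Gate K n A
  addG   : A → K → A → K → Gate K n A
  mulG   : A → K → A → K → Gate K n A

mapGate : ∀ {c} {K : Set c} {n} {A B : Set} → (A → B) → Gate K n A → Gate K n B
mapGate f (constG a) = constG a
mapGate f (varG x) = varG x
mapGate f (addG a wa b wb) = addG (f a) wa (f b) wb
mapGate f (mulG a wa b wb) = mulG (f a) wa (f b) wb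

-- A circuit with s nodes, listed in reverse topological order: the head
-- node (index zero) may only refer to the nodes of the tail circuit.
data Circuit {c} (K : Set c) (n : ℕ) : ℕ → Set c where
  []  : Circuit K n 0
  _∷_ : ∀ {s} → Gate K n (Fin s) → Circuit K n s → Circuit K n (suc s)

gateAt : ∀ {c} {K : Set c} {n s} → Circuit K n s → Fin s → Gate K n (Fin s)
gateAt (g ∷ C) Fin.zero    = mapGate Fin.suc g
gateAt (g ∷ C) (Fin.suc i) = mapGate Fin.suc (gateAt C i)

deg : ∀ {c} {K : Set c} {n s} → Circuit K n s → Fin s → ℕ
deg (g ∷ C) Fin.zero = degGate g
  where
  degGate : _ → ℕ
  degGate (constG _) = 0
  degGate (varG _) = 1
  degGate (addG a _ b _) = deg C a ⊔ℕ deg C b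
  degGate (mulG a _ b _) = deg C a +ℕ deg C b
deg (g ∷ C) (Fin.suc i) = deg C i

module CircuitDefs {c ℓ} (F : CommutativeRing c ℓ) (n : ℕ) where
  open CommutativeRing F
  open Poly F n public

  Circ : ℕ → Set c
  Circ = Circuit Carrier n

  eval : ∀ {s} → Circ s → Fin s → Pol
  eval (g ∷ C) Fin.zero = evalGate g
    where
    evalGate : _ → Pol
    evalGate (constG a) = constP a
    evalGate (varG x) = varP x
    evalGate (addG a wa b wb) = scaleP wa (eval C a) +P scaleP wb (eval C b)
    evalGate (mulG a wa b wb) = scaleP wa (eval C a) *P scaleP wb (eval C b)
  eval (g ∷ C) (Fin.suc i) = eval C i

  Computes : ∀ {s} → Circ s → Pol → Set ℓ
  Computes {s} Ψ f = Σ (Fin s) (λ i → eval Ψ i ≈P f)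

  module _ {s : ℕ} (Ψ : Circ s) where

    IsMulWithLeft : Fin s → Fin s → Set c
    IsMulWithLeft i a = Σ Carrier λ wa → Σ (Fin s) λ b → Σ Carrier λ wb →
                          gateAt Ψ i ≡ mulG a wa b wb

    IsMul : Fin s → Set c
    IsMul i = Σ (Fin s) (IsMulWithLeft i)

    maxDeg : ℕ
    maxDeg = foldr _⊔ℕ_ 0 (map (deg Ψ) (allFin s))

    -- l_1 < ... < l_{d'} : the distinct syntactic degrees of nodes of Ψ,
    -- in increasing order (stored 0-based: levels k = 0 .. d'-1 stand
    -- for the paper's 1 .. d').
    levels : List ℕ
    levels = filter (λ d → any? (λ i → deg Ψ i ℕ.≟ d)) (upTo (suc maxDeg))

    d′ : ℕ
    d′ = length levels

    InP : ℕ → Fin s → Set c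
    InP k g = IsMul g × Σ (k < d′) (λ lt → deg Ψ g ≡ lookup levels (fromℕ< lt))

    InM : ℕ → Pol → Set (c ⊔ ℓ)
    InM k p = Σ (Fin s) λ g → Σ (Fin s) λ a →
                InP k g × IsMulWithLeft g a × (p ≈P Xpart (eval Ψ a))

    InB₁ : Pol → Set ℓ
    InB₁ v = (v ≈P oneP) ⊎ Σ (Fin n) (λ i → v ≈P varP (inj₁ i))

    InB : ℕ → Pol → Set (c ⊔ ℓ)
    InB zero v = Lift c (InB₁ v)
    InB (suc k) v =
        InB k v
      ⊎ (Σ (Fin s) λ g → InP (suc k) g × (v ≈P Xpart (eval Ψ g)))
      ⊎ (Σ Pol λ p → Σ Pol λ h → InM (suc k) p × InB k h × (v ≈P (p *P h)))

    InQ : Pol → Set (c ⊔ ℓ)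
    InQ q = Lift c (InB₁ q) ⊎ Σ (Fin s) (λ g → IsMul g × (q ≈P Xpart (eval Ψ g)))

    prodWith : List (ℕ × Pol) → Pol → Pol
    prodWith ps q = foldr (λ mp acc → proj₂ mp *P acc) q ps

    -- valid parameterization v = p_1 ⋯ p_r q, given as the list
    -- ((m_1,p_1),...,(m_r,p_r)) and q; class indices 0-based, so the
    -- condition d' ≥ m_1 > ... > m_r ≥ 1 becomes d' > m_1 > ... > m_r ≥ 0.
    record ValidParam (v : Pol) (ps : List (ℕ × Pol)) (q : Pol) : Set (c ⊔ ℓ) where
      field
        decreasing : Linked _>_ (map proj₁ ps)
        bounded    : All (λ mp → proj₁ mp < d′) ps
        inM        : All (λ mp → InM (proj₁ mp) (proj₂ mp)) ps
        inQ        : InQ q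
        equation   : v ≈P prodWith ps q

    HasParamUpTo : ℕ → Pol → Set (c ⊔ ℓ)
    HasParamUpTo k v = Σ (List (ℕ × Pol)) λ ps → Σ Pol λ q →
                         ValidParam v ps q × All (λ mp → proj₁ mp ≤ k) ps

-- B_1 ⊆ Q, and every ĝ_X with g ∈ P_k lies in Q, so these are parameterizations of
-- length 0.  An element p h of B_k with p ∈ M_k and h ∈ B_{k-1} is parameterized
-- by prefixing p, with class index k, to a parameterization of h whose class
-- indices are at most k-1 by induction; this keeps the indices strictly decreasing.
module Submission where

open import Defs
open import Algebra.Bundles using (CommutativeRing)
open import Data.Nat using (ℕ; zero; suc; _<_; _≤_; _>_; s≤s)
open import Data.Nat.Properties using (≤-refl; m≤n⇒m≤1+n; <⇒≤)
open import Data.Maybe.Relation.Binary.Connected using (just; just-nothing)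
open import Data.Product using (_×_; _,_; proj₁; proj₂)
open import Data.Sum using (inj₁; inj₂)
open import Data.List using (List; []; _∷_; foldr)
open import Data.List.Relation.Unary.All as All using (All; []; _∷_)
open import Data.List.Relation.Unary.All.Properties using (map⁺)
open import Data.List.Relation.Unary.Linked using (Linked; []; _∷′_)
open import Level using (lift)

linked-∷-above : ∀ {k ks} → All (_≤ k) ks → Linked _>_ ks → Linked _>_ (suc k ∷ ks)
linked-∷-above []         ks↓ = just-nothing ∷′ ks↓
linked-∷-above (j≤k ∷ _)  ks↓ = just (s≤s j≤k) ∷′ ks↓

module _ {c ℓ} (F : CommutativeRing c ℓ) (n : ℕ) where
  open CommutativeRing F
  open Poly F n

  *P-congˡ : ∀ p {q q′} → q ≈P q′ → (p *P q) ≈P (p *P q′)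
  *P-congˡ p {q} {q′} q≈q′ w = sum-cong (splits w)
    where
    sumWith : Pol → List (Word n × Word n) → Carrier
    sumWith r = foldr (λ uv acc → (p (proj₁ uv) * r (proj₂ uv)) + acc) 0#

    sum-cong : ∀ uvs → sumWith q uvs ≈ sumWith q′ uvs
    sum-cong []         = refl
    sum-cong (uv ∷ uvs) = +-cong (*-cong refl (q≈q′ (proj₂ uv))) (sum-cong uvs)

module _ {c ℓ} (F : CommutativeRing c ℓ) {n s : ℕ} (Ψ : Circuit (CommutativeRing.Carrier F) n s) where
  open CommutativeRing F
  open CircuitDefs F n
  open ValidParam

  hasParam-Q : ∀ {k v} → InQ Ψ v → HasParamUpTo Ψ k v
  hasParam-Q {v = v} v∈Q = [] , v , vp , []
    where
    vp : ValidParam Ψ v [] v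
    vp = record { decreasing = [] ; bounded = [] ; inM = [] ; inQ = v∈Q ; equation = λ _ → refl }

  hasParam-resp-≈ : ∀ {k v v′} → v ≈P v′ → HasParamUpTo Ψ k v′ → HasParamUpTo Ψ k v
  hasParam-resp-≈ {v = v} v≈v′ (ps , q , vp , ps≤k) =
    ps , q , vp′ , ps≤k
    where
    vp′ : ValidParam Ψ v ps q
    vp′ = record
      { decreasing = decreasing vp
      ; bounded    = bounded vp
      ; inM        = inM vp
      ; inQ        = inQ vp
      ; equation   = λ w → trans (v≈v′ w) (equation vp w)
      }

  hasParam-suc : ∀ {k v} → HasParamUpTo Ψ k v → HasParamUpTo Ψ (suc k) v
  hasParam-suc (ps , q , vp , ps≤k) = ps , q , vp , All.map m≤n⇒m≤1+n ps≤k

  hasParam-*M : ∀ {k p h} → suc k < d′ Ψ → InM Ψ (suc k) p → HasParamUpTo Ψ k h →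
                HasParamUpTo Ψ (suc k) (p *P h)
  hasParam-*M {k} {p} {h} sk<d′ p∈M (ps , q , vp , ps≤k) =
    (suc k , p) ∷ ps , q , pvp , ≤-refl ∷ All.map m≤n⇒m≤1+n ps≤k
    where
    pvp : ValidParam Ψ (p *P h) ((suc k , p) ∷ ps) q
    pvp = record
      { decreasing = linked-∷-above (map⁺ ps≤k) (decreasing vp)
      ; bounded    = sk<d′ ∷ bounded vp
      ; inM        = p∈M ∷ inM vp
      ; inQ        = inQ vp
      ; equation   = *P-congˡ F n p (equation vp)
      }

  InB⇒hasParam : ∀ k → k < d′ Ψ → ∀ {v} → InB Ψ k v → HasParamUpTo Ψ k v
  InB⇒hasParam zero    _    (lift v∈B₁) = hasParam-Q (inj₁ (lift v∈B₁))
  InB⇒hasParam (suc k) sk<d′ (inj₁ v∈B) = hasParam-suc (InB⇒hasParam k (<⇒≤ sk<d′) v∈B)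
  InB⇒hasParam (suc k) _    (inj₂ (inj₁ (g , (g-mul , _) , v≈g))) =
    hasParam-resp-≈ v≈g (hasParam-Q (inj₂ (g , g-mul , λ _ → refl)))
  InB⇒hasParam (suc k) sk<d′ (inj₂ (inj₂ (p , h , p∈M , h∈B , v≈ph))) =
    hasParam-resp-≈ v≈ph (hasParam-*M sk<d′ p∈M (InB⇒hasParam k (<⇒≤ sk<d′) h∈B))

lemma7 : ∀ {c ℓ} (F : CommutativeRing c ℓ) → IsField F → (n s : ℕ) → (Ψ : Circuit (CommutativeRing.Carrier F) n s) → CircuitDefs.Computes F n Ψ (Poly.Pal F n) →
    ∀ (k : ℕ) → k < CircuitDefs.d′ F n Ψ →
    ∀ (v : Poly.Pol F n) → CircuitDefs.InB F n Ψ k v → CircuitDefs.HasParamUpTo F n Ψ k v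
lemma7 F _ n s Ψ _ k k<d′ _ = InB⇒hasParam F Ψ k k<d′
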